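{- Let $Q$ be a cycle with a fixed orientation, let $r\ge2$ be an integer, and let $(Z_1,Z_2,Z_3,Z_4)$ be a nontrivial $(Q,r)$-scheme. (c1) If $r\ge 4$, $|Z_1|+|Z_2|\ge 8$ and $|Z_3|=|Z_4|=1$, then $|Q|\ge 2(|Z_1|+|Z_2|)+4r-16$. (c2) If $|Z_2|=|Z_3|=|Z_4|=1$, then $|Q|\ge 2|Z_1|+4r-8$. (c3) If $|Z_1|=|Z_2|=|Z_3|=|Z_4|=1$, then $|Q|\ge 4r$.
   Context: $|Q|$ denotes the length (number of edges) of $Q$. For vertices $x,y$ of $Q$, $x\overrightarrow{Q}y$ is the segment of $Q$ from $x$ to $y$ in the chosen direction; it is an $m$-segment if its length (number of edges) is at least $m$. Given subsets $Z_1,\dots,Z_p\subseteq V(Q)$ ($p\ge2$), the collection $(Z_1,\dots,Z_p)$ is a $(Q,r)$-scheme if $x\overrightarrow{Q}y$ is a $2$-segment for all distinct $x,y\in Z_i$ (any $i$), and is an $r$-segment for all distinct $x\in Z_i$, $y\in Z_j$ with $i\ne j$. It is nontrivial if $(Z_1,\dots,Z_p)$ has a system of distinct representatives (distinct vertices $z_1,\dots,z_p$ with $z_i\in Z_i$). -}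

module Defs where

open import Data.Nat using (ℕ; _+_; _∸_; _≤_; _≤ᵇ_)
open import Data.Bool using (if_then_else_)
open import Data.Fin using (Fin; toℕ)
open import Data.Fin.Subset using (Subset; _∈_)
open import Data.Product using (Σ; _×_)
open import Function.Definitions using (Injective)
open import Relation.Binary.PropositionalEquality using (_≡_)
open import Relation.Nullary using (¬_)

-- The cycle Q of length n has vertex set Fin n and edges {i, i+1 mod n};
-- its fixed orientation is the direction of increasing index (mod n).
-- segLen n x y = |x Q→ y| = number of edges of the segment of Q from x
-- to y in the chosen direction.
segLen : (n : ℕ) → Fin n → Fin n → ℕ
segLen n x y =
  if toℕ x ≤ᵇ toℕ y then toℕ y ∸ toℕ x else (n + toℕ y) ∸ toℕ x

IsSegment : (n : ℕ) → ℕ → Fin n → Fin n → Set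
IsSegment n m x y = m ≤ segLen n x y

IsScheme : (n r p : ℕ) → (Fin p → Subset n) → Set
IsScheme n r p Z =
  (∀ i (x y : Fin n) → x ∈ Z i → y ∈ Z i → ¬ x ≡ y → IsSegment n 2 x y)
  × (∀ i j (x y : Fin n) → ¬ i ≡ j → x ∈ Z i → y ∈ Z j → ¬ x ≡ y → IsSegment n r x y)

Nontrivial : (n p : ℕ) → (Fin p → Subset n) → Set
Nontrivial n p Z = Σ (Fin p → Fin n) λ z → Injective _≡_ _≡_ z × (∀ i → z i ∈ Z i)

-- Unroll the cycle onto ℕ: position t stands for the vertex t mod n, and for g < n the segment from the
-- vertex at s to the vertex at s + g has length g. Call a position occupied when its vertex lies in some Z i.
-- Occupied positions less than n apart are at least 2 apart, and at least r apart when they carry different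
-- classes. Met in cyclic order from z₀, the representatives z₀, …, z₃ cut the cycle into four arcs, each
-- joining two different classes, so each arc contains two consecutive occupied positions of different classes.
-- Charge every occupied position a weight v bounded by the gap that follows it, and by r − e when the class
-- changes across that gap; summing over the cycle gives Σ v + 4e ≤ n. The weights 2[x ∈ Z₀] + 2[x ∈ Z₁],
-- 2[x ∈ Z₀] and 0, with e = r − 4, r − 2 and r, give (c1), (c2) and (c3).
module Submission where

open import Defs
open import Data.Bool using (true; false; if_then_else_)
open import Data.Fin using (Fin; toℕ; #_)
open import Data.Fin.Properties using (toℕ-fromℕ<; toℕ<n; toℕ-injective; any?) renaming (_≟_ to _≟ᶠ_)
open import Data.Fin.Subset using (Subset; _∈_; ∣_∣; inside; outside)
open import Data.Fin.Subset.Properties using (_∈?_)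
open import Data.Nat using (ℕ; zero; suc; _+_; _*_; _∸_; _≤_; _<_; _≤ᵇ_; z≤n; s≤s; NonZero; >-nonZero; _%_)
open import Data.Nat.DivMod using (_mod_; m%n<n; %-distribˡ-+; m<n⇒m%n≡m; m≤n⇒[n∸m]%m≡n%m; [m+n]%n≡m%n)
open import Data.Nat.Induction using (<-rec; <-Rec)
open import Data.Nat.Properties
open import Algebra.Properties.CommutativeSemigroup +-commutativeSemigroup using (interchange; xy∙z≈xz∙y)
open import Data.Product using (Σ-syntax; ∃; _×_; _,_; proj₁; proj₂)
open import Data.Unit using (tt)
open import Data.Vec using (_∷_; [])
open import Function using (_∘_)
open import Function.Definitions using (Injective)
open import Relation.Binary.Definitions using (DecidableEquality; tri<; tri≈; tri>)
open import Relation.Binary.PropositionalEquality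
open import Relation.Nullary using (¬_; Dec; does; yes; no; contradiction)
open import Relation.Unary using (Decidable)

𝟙 : {A : Set} → Dec A → ℕ
𝟙 d = if does d then 1 else 0

𝟙≤1 : ∀ {A : Set} (d : Dec A) → 𝟙 d ≤ 1
𝟙≤1 d with does d
... | true  = s≤s z≤n
... | false = z≤n

sumFrom : (ℕ → ℕ) → ℕ → ℕ → ℕ
sumFrom w a zero    = 0
sumFrom w a (suc k) = w a + sumFrom w (suc a) k

module _ (w : ℕ → ℕ) where

  sumFrom-split : ∀ a k l → sumFrom w a (k + l) ≡ sumFrom w a k + sumFrom w (a + k) l
  sumFrom-split a zero    l = cong (λ b → sumFrom w b l) (sym (+-identityʳ a))
  sumFrom-split a (suc k) l = begin
    w a + sumFrom w (suc a) (k + l)                          ≡⟨ cong (w a +_) (sumFrom-split (suc a) k l) ⟩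
    w a + (sumFrom w (suc a) k + sumFrom w (suc a + k) l)    ≡⟨ sym (+-assoc (w a) _ _) ⟩
    w a + sumFrom w (suc a) k + sumFrom w (suc a + k) l      ≡⟨ cong (λ b → w a + sumFrom w (suc a) k + sumFrom w b l) (sym (+-suc a k)) ⟩
    w a + sumFrom w (suc a) k + sumFrom w (a + suc k) l      ∎
    where open ≡-Reasoning

  sumFrom-suc : ∀ a k → sumFrom w (suc a) k ≡ sumFrom (w ∘ suc) a k
  sumFrom-suc a zero    = refl
  sumFrom-suc a (suc k) = cong (w (suc a) +_) (sumFrom-suc (suc a) k)

  sumFrom-zero : ∀ a k → (∀ j → j < k → w (a + j) ≡ 0) → sumFrom w a k ≡ 0
  sumFrom-zero a zero    _    = refl
  sumFrom-zero a (suc k) vanish = cong₂ _+_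
    (trans (cong w (sym (+-identityʳ a))) (vanish 0 (s≤s z≤n)))
    (sumFrom-zero (suc a) k λ j j<k → trans (cong w (sym (+-suc a j))) (vanish (suc j) (s≤s j<k)))

  sumFrom-periodic : ∀ N → (∀ t → w (t + N) ≡ w t) → ∀ a → sumFrom w a N ≡ sumFrom w 0 N
  sumFrom-periodic N periodic zero    = refl
  sumFrom-periodic N periodic (suc a) = trans (+-cancelˡ-≡ (w a) _ _ shift) (sumFrom-periodic N periodic a)
    where
    open ≡-Reasoning
    shift : w a + sumFrom w (suc a) N ≡ w a + sumFrom w a N
    shift = begin
      sumFrom w a (suc N)                  ≡⟨ cong (sumFrom w a) (+-comm 1 N) ⟩
      sumFrom w a (N + 1)                  ≡⟨ sumFrom-split a N 1 ⟩
      sumFrom w a N + (w (a + N) + 0)      ≡⟨ cong (λ x → sumFrom w a N + x) (trans (+-identityʳ _) (periodic a)) ⟩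
      sumFrom w a N + w a                  ≡⟨ +-comm _ (w a) ⟩
      w a + sumFrom w a N                  ∎

sumFrom-+ : ∀ w v a k → sumFrom (λ t → w t + v t) a k ≡ sumFrom w a k + sumFrom v a k
sumFrom-+ w v a zero    = refl
sumFrom-+ w v a (suc k) = trans (cong (w a + v a +_) (sumFrom-+ w v (suc a) k))
  (interchange (w a) (v a) _ _)

sumFrom-* : ∀ c w a k → sumFrom (λ t → c * w t) a k ≡ c * sumFrom w a k
sumFrom-* c w a zero    = sym (*-zeroʳ c)
sumFrom-* c w a (suc k) = trans (cong (c * w a +_) (sumFrom-* c w (suc a) k)) (sym (*-distribˡ-+ c (w a) _))

sumFrom≡∣p∣ : ∀ {n} (p : Subset n) (w : ℕ → ℕ) → (∀ x → w (toℕ x) ≡ 𝟙 (x ∈? p)) → sumFrom w 0 n ≡ ∣ p ∣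
sumFrom≡∣p∣ []                    w w≡ = refl
sumFrom≡∣p∣ {suc n} (inside ∷ p)  w w≡ = cong₂ _+_ (w≡ Fin.zero) (trans (sumFrom-suc w 0 n) (sumFrom≡∣p∣ p (w ∘ suc) (w≡ ∘ Fin.suc)))
sumFrom≡∣p∣ {suc n} (outside ∷ p) w w≡ = cong₂ _+_ (w≡ Fin.zero) (trans (sumFrom-suc w 0 n) (sumFrom≡∣p∣ p (w ∘ suc) (w≡ ∘ Fin.suc)))

∸-telescope : ∀ {lo mid hi} → lo ≤ mid → mid ≤ hi → hi ∸ lo ≡ (mid ∸ lo) + (hi ∸ mid)
∸-telescope {lo} {mid} {hi} lo≤mid mid≤hi = begin
  hi ∸ lo                    ≡⟨ cong (_∸ lo) (m∸n+n≡m mid≤hi) ⟨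
  (hi ∸ mid) + mid ∸ lo      ≡⟨ +-∸-assoc (hi ∸ mid) lo≤mid ⟩
  (hi ∸ mid) + (mid ∸ lo)    ≡⟨ +-comm (hi ∸ mid) _ ⟩
  (mid ∸ lo) + (hi ∸ mid)    ∎
  where open ≡-Reasoning

∸-bound : ∀ {A k r n} → k ≤ r → A + 4 * (r ∸ k) ≤ n → (A + 4 * r) ∸ 4 * k ≤ n
∸-bound {A} {k} {r} {n} k≤r bound = begin
  (A + 4 * r) ∸ 4 * k    ≡⟨ +-∸-assoc A (*-monoʳ-≤ 4 k≤r) ⟩
  A + (4 * r ∸ 4 * k)    ≡⟨ cong (A +_) (*-distribˡ-∸ 4 r k) ⟨
  A + 4 * (r ∸ k)        ≤⟨ bound ⟩
  n                      ∎
  where open ≤-Reasoning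

by-order : ∀ {G : Set} {a b c : ℕ} → a ≢ b → b ≢ c → a ≢ c →
           (a < b → b < c → G) → (a < c → c < b → G) → (b < a → a < c → G) →
           (b < c → c < a → G) → (c < a → a < b → G) → (c < b → b < a → G) → G
by-order {a = a} {b} {c} a≢b b≢c a≢c abc acb bac bca cab cba with <-cmp a b | <-cmp b c | <-cmp a c
... | tri≈ _ a≡b _ | _            | _            = contradiction a≡b a≢b
... | _            | tri≈ _ b≡c _ | _            = contradiction b≡c b≢c
... | _            | _            | tri≈ _ a≡c _ = contradiction a≡c a≢c
... | tri< a<b _ _ | tri< b<c _ _ | _            = abc a<b b<c
... | tri< a<b _ _ | tri> _ _ c<b | tri< a<c _ _ = acb a<c c<b
... | tri< a<b _ _ | tri> _ _ c<b | tri> _ _ c<a = cab c<a a<b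
... | tri> _ _ b<a | tri< b<c _ _ | tri< a<c _ _ = bac b<a a<c
... | tri> _ _ b<a | tri< b<c _ _ | tri> _ _ c<a = bca b<c c<a
... | tri> _ _ b<a | tri> _ _ c<b | _            = cba c<b b<a

least-witness : ∀ {Q : ℕ → Set} → Decidable Q → ∀ k → Q k → Σ[ g ∈ ℕ ] g ≤ k × Q g × (∀ j → j < g → ¬ Q j)
least-witness Q? zero q = 0 , z≤n , q , λ _ ()
least-witness Q? (suc k) q with Q? 0
... | yes q₀ = 0 , z≤n , q₀ , λ _ ()
... | no ¬q₀ with least-witness (Q? ∘ suc) k q
...   | g , g≤k , q-g , below = suc g , s≤s g≤k , q-g , λ where
          zero    _         → ¬q₀
          (suc j) (s≤s j<g) → below j j<g

module _ {n : ℕ} .{{_ : NonZero n}} where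

  segLen-≤ : ∀ {x y : Fin n} → toℕ x ≤ toℕ y → segLen n x y ≡ toℕ y ∸ toℕ x
  segLen-≤ {x} {y} x≤y with toℕ x ≤ᵇ toℕ y | ≤⇒≤ᵇ x≤y
  ... | true | _ = refl

  segLen-> : ∀ {x y : Fin n} → toℕ y < toℕ x → segLen n x y ≡ n + toℕ y ∸ toℕ x
  segLen-> {x} {y} y<x with toℕ x ≤ᵇ toℕ y | ≤ᵇ⇒≤ (toℕ x) (toℕ y)
  ... | false | _   = refl
  ... | true  | x≤y = contradiction (x≤y tt) (<⇒≱ y<x)

  segLen-refl : ∀ (x : Fin n) → segLen n x x ≡ 0
  segLen-refl x = trans (segLen-≤ {x} {x} ≤-refl) (n∸n≡0 (toℕ x))

  toℕ-mod : ∀ t → toℕ (t mod n) ≡ t % n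
  toℕ-mod t = toℕ-fromℕ< (m%n<n t n)

  toℕ-mod-id : ∀ (x : Fin n) → toℕ x mod n ≡ x
  toℕ-mod-id x = toℕ-injective (trans (toℕ-mod (toℕ x)) (m<n⇒m%n≡m (toℕ<n x)))

  toℕ-mod-+ : ∀ s {g} → g < n → toℕ ((s + g) mod n) ≡ (s % n + g) % n
  toℕ-mod-+ s {g} g<n = begin
    toℕ ((s + g) mod n)  ≡⟨ toℕ-mod (s + g) ⟩
    (s + g) % n          ≡⟨ %-distribˡ-+ s g n ⟩
    (s % n + g % n) % n  ≡⟨ cong (λ h → (s % n + h) % n) (m<n⇒m%n≡m g<n) ⟩
    (s % n + g) % n      ∎
    where open ≡-Reasoning

  segLen-mod : ∀ s {g} → g < n → segLen n (s mod n) ((s + g) mod n) ≡ g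
  segLen-mod s {g} g<n with s % n + g <? n
  ... | yes a+g<n = begin
    segLen n (s mod n) ((s + g) mod n)   ≡⟨ segLen-≤ (subst₂ _≤_ (sym (toℕ-mod s)) (sym b≡) (m≤m+n _ g)) ⟩
    toℕ ((s + g) mod n) ∸ toℕ (s mod n)  ≡⟨ cong₂ _∸_ b≡ (toℕ-mod s) ⟩
    s % n + g ∸ s % n                    ≡⟨ m+n∸m≡n (s % n) g ⟩
    g                                    ∎
    where
    open ≡-Reasoning
    b≡ : toℕ ((s + g) mod n) ≡ s % n + g
    b≡ = trans (toℕ-mod-+ s g<n) (m<n⇒m%n≡m a+g<n)
  ... | no a+g≮n = begin
    segLen n (s mod n) ((s + g) mod n)       ≡⟨ segLen-> (subst₂ _<_ (sym b≡) (sym (toℕ-mod s)) wraps) ⟩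
    n + toℕ ((s + g) mod n) ∸ toℕ (s mod n)  ≡⟨ cong₂ (λ b a → n + b ∸ a) b≡ (toℕ-mod s) ⟩
    n + (a + g ∸ n) ∸ a                      ≡⟨ cong (_∸ a) (m+[n∸m]≡n n≤a+g) ⟩
    a + g ∸ a                                ≡⟨ m+n∸m≡n a g ⟩
    g                                        ∎
    where
    open ≡-Reasoning
    a : ℕ
    a = s % n
    n≤a+g : n ≤ a + g
    n≤a+g = ≮⇒≥ a+g≮n
    b≡ : toℕ ((s + g) mod n) ≡ a + g ∸ n
    b≡ = begin
      toℕ ((s + g) mod n)  ≡⟨ toℕ-mod-+ s g<n ⟩
      (a + g) % n          ≡⟨ m≤n⇒[n∸m]%m≡n%m n≤a+g ⟨
      (a + g ∸ n) % n      ≡⟨ m<n⇒m%n≡m (+-cancelˡ-< n _ _ (subst (_< n + n) (sym (m+[n∸m]≡n n≤a+g)) (+-mono-< (m%n<n s n) g<n))) ⟩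
      a + g ∸ n            ∎
    wraps : a + g ∸ n < a
    wraps = +-cancelˡ-< n _ _ (subst (_< n + a) (sym (m+[n∸m]≡n n≤a+g)) (subst (a + g <_) (+-comm a n) (+-monoʳ-< a g<n)))

  segLen<n : ∀ (x y : Fin n) → segLen n x y < n
  segLen<n x y with toℕ x ≤? toℕ y
  ... | yes x≤y = subst (_< n) (sym (segLen-≤ x≤y)) (≤-<-trans (m∸n≤m (toℕ y) (toℕ x)) (toℕ<n y))
  ... | no  x≰y = subst (_< n) (sym (segLen-> y<x)) (m<n+o⇒m∸n<o (n + toℕ y) (toℕ x) (subst (n + toℕ y <_) (+-comm n (toℕ x)) (+-monoʳ-< n y<x)))
    where
    y<x : toℕ y < toℕ x
    y<x = ≰⇒> x≰y

  mod-segLen : ∀ (x y : Fin n) → (toℕ x + segLen n x y) mod n ≡ y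
  mod-segLen x y = toℕ-injective (trans (toℕ-mod _) (arrive (toℕ x ≤? toℕ y)))
    where
    arrive : Dec (toℕ x ≤ toℕ y) → (toℕ x + segLen n x y) % n ≡ toℕ y
    arrive (yes x≤y) rewrite segLen-≤ x≤y | m+[n∸m]≡n x≤y = m<n⇒m%n≡m (toℕ<n y)
    arrive (no  x≰y) rewrite segLen-> (≰⇒> x≰y) | m+[n∸m]≡n (≤-trans (<⇒≤ (toℕ<n x)) (m≤m+n n (toℕ y)))
      | +-comm n (toℕ y) = trans ([m+n]%n≡m%n (toℕ y) n) (m<n⇒m%n≡m (toℕ<n y))

Occupied : {I : Set} → (I → ℕ → Set) → ℕ → Set
Occupied In t = ∃ λ i → In i t

module Occupancy {I : Set} (In : I → ℕ → Set) (occupied? : Decidable (Occupied In)) where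

  record Gap (s g : ℕ) : Set where
    field
      positive : 0 < g
      start    : Occupied In s
      end      : Occupied In (s + g)
      empty    : ∀ j → 0 < j → j < g → ¬ Occupied In (s + j)

  next-point : ∀ {s k} → Occupied In s → 0 < k → Occupied In (s + k) →
               Σ[ g ∈ ℕ ] Σ[ m ∈ ℕ ] g + m ≡ k × Gap s g
  next-point {s} {suc k} occ-s _ occ-end with least-witness (occupied? ∘ (s +_) ∘ suc) k occ-end
  ... | g , g≤k , occ-g , below = suc g , k ∸ g , cong suc (m+[n∸m]≡n g≤k) , record
    { positive = s≤s z≤n
    ; start    = occ-s
    ; end      = occ-g
    ; empty    = λ { (suc j) _ (s≤s j<g) → below j j<g }
    }

  module Weighted (w : ℕ → ℕ) (N : ℕ)
    (w-off : ∀ {t} → ¬ Occupied In t → w t ≡ 0)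
    (w-gap : ∀ {s g} → g < N → Gap s g → w s ≤ g) where

    sumFrom-gap : ∀ {s g} → Gap s g → ∀ m → sumFrom w s (g + m) ≡ w s + sumFrom w (s + g) m
    sumFrom-gap {s} {suc g} gap m = begin
      sumFrom w s (suc g + m)                                ≡⟨ sumFrom-split w s (suc g) m ⟩
      w s + sumFrom w (suc s) g + sumFrom w (s + suc g) m    ≡⟨ cong (λ x → w s + x + sumFrom w (s + suc g) m) interior ⟩
      w s + 0 + sumFrom w (s + suc g) m                      ≡⟨ cong (_+ sumFrom w (s + suc g) m) (+-identityʳ (w s)) ⟩
      w s + sumFrom w (s + suc g) m                          ∎
      where
      open ≡-Reasoning
      interior : sumFrom w (suc s) g ≡ 0
      interior = sumFrom-zero w (suc s) g λ j j<g →
        w-off (Gap.empty gap (suc j) (s≤s z≤n) (s≤s j<g) ∘ subst (Occupied In) (sym (+-suc s j)))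

    gap-sum : ∀ k {s} → k < N → Occupied In s → Occupied In (s + k) → sumFrom w s k ≤ k
    gap-sum = <-rec _ bound
      where
      Claim : ℕ → Set
      Claim k = ∀ {s} → k < N → Occupied In s → Occupied In (s + k) → sumFrom w s k ≤ k
      bound : ∀ k → <-Rec Claim k → Claim k
      bound zero    _   _ _ _ = z≤n
      bound (suc k) rec {s} k<N occ-s occ-end with next-point occ-s (s≤s z≤n) occ-end
      ... | g , m , g+m≡k , gap = subst (λ k → sumFrom w s k ≤ k) g+m≡k (begin
        sumFrom w s (g + m)          ≡⟨ sumFrom-gap gap m ⟩
        w s + sumFrom w (s + g) m    ≤⟨ +-mono-≤ (w-gap (≤-<-trans (m≤m+n g m) g+m<N) gap) rest ⟩
        g + m                        ∎)
        where
        open ≤-Reasoning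
        g+m<N : g + m < N
        g+m<N = subst (_< N) (sym g+m≡k) k<N
        rest : sumFrom w (s + g) m ≤ m
        rest = rec (subst (m <_) g+m≡k (+-monoˡ-< m (Gap.positive gap))) (≤-<-trans (m≤n+m m g) g+m<N) (Gap.end gap)
                   (subst (Occupied In) (sym (+-assoc s g m)) (subst (λ k → Occupied In (s + k)) (sym g+m≡k) occ-end))

    module ClassChanges (_≟_ : DecidableEquality I) (e : ℕ)
      (w-change : ∀ {s g i j} → i ≢ j → g < N → Gap s g → In i s → In j (s + g) → w s + e ≤ g) where

      excess-at-gap : ∀ {s g m i j} → i ≢ j → g < N → Gap s g → In i s → In j (s + g) →
                      sumFrom w (s + g) m ≤ m → sumFrom w s (g + m) + e ≤ g + m
      excess-at-gap {s} {g} {m} i≢j g<N gap i∈ j∈ rest = begin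
        sumFrom w s (g + m) + e          ≡⟨ cong (_+ e) (sumFrom-gap gap m) ⟩
        w s + sumFrom w (s + g) m + e    ≡⟨ xy∙z≈xz∙y (w s) _ e ⟩
        w s + e + sumFrom w (s + g) m    ≤⟨ +-mono-≤ (w-change i≢j g<N gap i∈ j∈) rest ⟩
        g + m                            ∎
        where open ≤-Reasoning

      excess-after-gap : ∀ {s g m} → g < N → Gap s g → sumFrom w (s + g) m + e ≤ m → sumFrom w s (g + m) + e ≤ g + m
      excess-after-gap {s} {g} {m} g<N gap rest = begin
        sumFrom w s (g + m) + e          ≡⟨ cong (_+ e) (sumFrom-gap gap m) ⟩
        w s + sumFrom w (s + g) m + e    ≡⟨ +-assoc (w s) _ e ⟩
        w s + (sumFrom w (s + g) m + e)  ≤⟨ +-mono-≤ (w-gap g<N gap) rest ⟩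
        g + m                            ∎
        where open ≤-Reasoning

      arc-bound : ∀ k {s c d} → 0 < k → k < N → c ≢ d → In c s → In d (s + k) → sumFrom w s k + e ≤ k
      arc-bound = <-rec Claim bound
        where
        Claim : ℕ → Set
        Claim k = ∀ {s c d} → 0 < k → k < N → c ≢ d → In c s → In d (s + k) → sumFrom w s k + e ≤ k
        bound : ∀ k → <-Rec Claim k → Claim k
        -- Walk to the next occupied position: either the class changes in this gap, or we recurse from there.
        bound k rec {s} {c} {d} 0<k k<N c≢d c∈s d∈end with next-point (c , c∈s) 0<k (d , d∈end)
        ... | g , zero , refl , gap =
          excess-at-gap c≢d (≤-<-trans (m≤m+n g 0) k<N) gap c∈s (subst (In d) (cong (s +_) (+-identityʳ g)) d∈end) z≤n
        ... | g , suc m , refl , gap = continue (Gap.end gap)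
          where
          g<N : g < N
          g<N = ≤-<-trans (m≤m+n g (suc m)) k<N
          m<N : suc m < N
          m<N = ≤-<-trans (m≤n+m (suc m) g) k<N
          d∈end′ : In d (s + g + suc m)
          d∈end′ = subst (In d) (sym (+-assoc s g (suc m))) d∈end
          continue : Occupied In (s + g) → sumFrom w s (g + suc m) + e ≤ g + suc m
          continue (l , l∈) with l ≟ c
          ... | no l≢c   = excess-at-gap (l≢c ∘ sym) g<N gap c∈s l∈ (gap-sum (suc m) m<N (l , l∈) (d , d∈end′))
          ... | yes refl = excess-after-gap g<N gap (rec (+-monoˡ-< (suc m) (Gap.positive gap)) (s≤s z≤n) m<N c≢d l∈ d∈end′)

      Excess : ℕ → ℕ → ℕ → Set
      Excess a lo hi = sumFrom w lo (hi ∸ lo) + a * e ≤ hi ∸ lo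

      arc-excess : ∀ {lo hi c d} → lo < hi → hi < lo + N → c ≢ d → In c lo → In d hi → Excess 1 lo hi
      arc-excess {lo} {hi} {c} {d} lo<hi hi<lo+N c≢d c∈ d∈ =
        subst (λ x → sumFrom w lo (hi ∸ lo) + x ≤ hi ∸ lo) (sym (*-identityˡ e))
          (arc-bound (hi ∸ lo) (m<n⇒0<n∸m lo<hi) (+-cancelˡ-< lo _ _ (subst (_< lo + N) (sym lo+k≡hi) hi<lo+N)) c≢d c∈
             (subst (In d) (sym lo+k≡hi) d∈))
        where
        lo+k≡hi : lo + (hi ∸ lo) ≡ hi
        lo+k≡hi = m+[n∸m]≡n (<⇒≤ lo<hi)

      excess-++ : ∀ {a b lo mid hi} → lo ≤ mid → mid ≤ hi → Excess a lo mid → Excess b mid hi → Excess (a + b) lo hi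
      excess-++ {a} {b} {lo} {mid} {hi} lo≤mid mid≤hi left right = begin
        sumFrom w lo (hi ∸ lo) + (a + b) * e                     ≡⟨ cong₂ (λ k x → sumFrom w lo k + x) (∸-telescope lo≤mid mid≤hi) (*-distribʳ-+ e a b) ⟩
        sumFrom w lo (k + l) + (a * e + b * e)                   ≡⟨ cong (_+ (a * e + b * e)) (sumFrom-split w lo k l) ⟩
        sumFrom w lo k + sumFrom w (lo + k) l + (a * e + b * e)  ≡⟨ cong (λ x → sumFrom w lo k + sumFrom w x l + (a * e + b * e)) (m+[n∸m]≡n lo≤mid) ⟩
        sumFrom w lo k + sumFrom w mid l + (a * e + b * e)       ≡⟨ interchange (sumFrom w lo k) _ (a * e) _ ⟩
        (sumFrom w lo k + a * e) + (sumFrom w mid l + b * e)     ≤⟨ +-mono-≤ left right ⟩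
        k + l                                                    ≡⟨ ∸-telescope lo≤mid mid≤hi ⟨
        hi ∸ lo                                                  ∎
        where
        open ≤-Reasoning
        k l : ℕ
        k = mid ∸ lo
        l = hi ∸ mid

      four-arcs : ∀ {lo x y z hi c₀ c₁ c₂ c₃} → lo < x → x < y → y < z → z < hi → hi ≤ lo + N →
                  c₀ ≢ c₁ → c₁ ≢ c₂ → c₂ ≢ c₃ → c₃ ≢ c₀ →
                  In c₀ lo → In c₁ x → In c₂ y → In c₃ z → In c₀ hi → Excess 4 lo hi
      four-arcs {lo} {x} {y} {z} {hi} lo<x x<y y<z z<hi hi≤lo+N c₀≢c₁ c₁≢c₂ c₂≢c₃ c₃≢c₀ c₀∈lo c₁∈x c₂∈y c₃∈z c₀∈hi =
        excess-++ {1} {3} (<⇒≤ lo<x) (<⇒≤ x<hi) (arc-excess lo<x (<-≤-trans x<hi hi≤lo+N) c₀≢c₁ c₀∈lo c₁∈x)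
          (excess-++ {1} {2} (<⇒≤ x<y) (<⇒≤ y<hi) (arc-excess x<y (within lo<x (<⇒≤ y<hi)) c₁≢c₂ c₁∈x c₂∈y)
            (excess-++ {1} {1} (<⇒≤ y<z) (<⇒≤ z<hi) (arc-excess y<z (within (<-trans lo<x x<y) (<⇒≤ z<hi)) c₂≢c₃ c₂∈y c₃∈z)
              (arc-excess z<hi (within (<-trans lo<x (<-trans x<y y<z)) ≤-refl) c₃≢c₀ c₃∈z c₀∈hi)))
        where
        y<hi : y < hi
        y<hi = <-trans y<z z<hi
        x<hi : x < hi
        x<hi = <-trans x<y y<hi
        within : ∀ {a b} → lo < a → b ≤ hi → b < a + N
        within lo<a b≤hi = ≤-<-trans (≤-trans b≤hi hi≤lo+N) (+-monoˡ-< N lo<a)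

module OnCycle {n r p : ℕ} .{{_ : NonZero n}} (Z : Fin p → Subset n) (scheme : IsScheme n r p Z) where

  In : Fin p → ℕ → Set
  In i t = t mod n ∈ Z i

  occupied? : Decidable (Occupied In)
  occupied? t = any? λ i → t mod n ∈? Z i

  mod-periodic : ∀ t → (t + n) mod n ≡ t mod n
  mod-periodic t = toℕ-injective (trans (toℕ-mod (t + n)) (trans ([m+n]%n≡m%n t n) (sym (toℕ-mod t))))

  sumFrom-∈≡∣Z∣ : ∀ i → sumFrom (λ t → 𝟙 (t mod n ∈? Z i)) 0 n ≡ ∣ Z i ∣
  sumFrom-∈≡∣Z∣ i = sumFrom≡∣p∣ (Z i) _ λ x → cong (λ y → 𝟙 (y ∈? Z i)) (toℕ-mod-id x)

  mod-≢ : ∀ s {g} → 0 < g → g < n → s mod n ≢ (s + g) mod n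
  mod-≢ s {g} 0<g g<n eq = <⇒≢ 0<g (begin
    0                                   ≡⟨ segLen-refl (s mod n) ⟨
    segLen n (s mod n) (s mod n)        ≡⟨ cong (segLen n (s mod n)) eq ⟩
    segLen n (s mod n) ((s + g) mod n)  ≡⟨ segLen-mod s g<n ⟩
    g                                   ∎)
    where open ≡-Reasoning

  same-class-gap : ∀ {s g i} → 0 < g → g < n → In i s → In i (s + g) → 2 ≤ g
  same-class-gap {s} 0<g g<n i∈s i∈end =
    subst (2 ≤_) (segLen-mod s g<n) (proj₁ scheme _ _ _ i∈s i∈end (mod-≢ s 0<g g<n))

  class-change-gap : ∀ {s g i j} → i ≢ j → 0 < g → g < n → In i s → In j (s + g) → r ≤ g
  class-change-gap {s} i≢j 0<g g<n i∈s j∈end =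
    subst (r ≤_) (segLen-mod s g<n) (proj₂ scheme _ _ _ _ i≢j i∈s j∈end (mod-≢ s 0<g g<n))

  occupied-gap : ∀ {s g} → 2 ≤ r → 0 < g → g < n → Occupied In s → Occupied In (s + g) → 2 ≤ g
  occupied-gap 2≤r 0<g g<n (i , i∈s) (j , j∈end) with i ≟ᶠ j
  ... | yes refl = same-class-gap 0<g g<n i∈s j∈end
  ... | no  i≢j  = ≤-trans 2≤r (class-change-gap i≢j 0<g g<n i∈s j∈end)

module FourClasses {n r : ℕ} .{{_ : NonZero n}} (Z : Fin 4 → Subset n) (scheme : IsScheme n r 4 Z)
                   (nontrivial : Nontrivial n 4 Z) where

  open OnCycle Z scheme

  private
    z : Fin 4 → Fin n
    z = proj₁ nontrivial
    z-injective : Injective _≡_ _≡_ z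
    z-injective = proj₁ (proj₂ nontrivial)
    z∈Z : ∀ i → z i ∈ Z i
    z∈Z = proj₂ (proj₂ nontrivial)

  origin : ℕ
  origin = toℕ (z (# 0))

  offset : Fin 4 → ℕ
  offset i = segLen n (z (# 0)) (z i)

  In-offset : ∀ i → In i (origin + offset i)
  In-offset i = subst (_∈ Z i) (sym (mod-segLen (z (# 0)) (z i))) (z∈Z i)

  offset-injective : ∀ {i j} → offset i ≡ offset j → i ≡ j
  offset-injective {i} {j} eq = z-injective (begin
    z i                        ≡⟨ mod-segLen (z (# 0)) (z i) ⟨
    (origin + offset i) mod n  ≡⟨ cong (λ d → (origin + d) mod n) eq ⟩
    (origin + offset j) mod n  ≡⟨ mod-segLen (z (# 0)) (z j) ⟩
    z j                        ∎)
    where open ≡-Reasoning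

  offset-ordered⇒≢ : ∀ {i j} → offset i < offset j → i ≢ j
  offset-ordered⇒≢ lt refl = <-irrefl refl lt

  offset-zero : offset (# 0) ≡ 0
  offset-zero = segLen-refl (z (# 0))

  0<offset⇒≢0 : ∀ {i} → 0 < offset i → # 0 ≢ i
  0<offset⇒≢0 {i} 0<i = offset-ordered⇒≢ (subst (_< offset i) (sym offset-zero) 0<i)

  ≢0⇒0<offset : ∀ {i} → # 0 ≢ i → 0 < offset i
  ≢0⇒0<offset 0≢i = n≢0⇒n>0 λ eq → 0≢i (offset-injective (trans offset-zero (sym eq)))

  cycle-bound : ∀ (v : Fin n → ℕ) e →
    (∀ {t} → ¬ Occupied In t → v (t mod n) ≡ 0) →
    (∀ {t g} → 0 < g → g < n → Occupied In t → Occupied In (t + g) → v (t mod n) ≤ g) →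
    (∀ x → v x + e ≤ r) →
    sumFrom (λ t → v (t mod n)) 0 n + 4 * e ≤ n
  cycle-bound v e v-off v-gap v+e≤r = begin
    sumFrom w 0 n + 4 * e                           ≡⟨ cong (_+ 4 * e) (sumFrom-periodic w n (cong v ∘ mod-periodic) origin) ⟨
    sumFrom w origin n + 4 * e                      ≡⟨ cong (λ k → sumFrom w origin k + 4 * e) (m+n∸m≡n origin n) ⟨
    sumFrom w origin (origin + n ∸ origin) + 4 * e  ≤⟨ around ⟩
    origin + n ∸ origin                             ≡⟨ m+n∸m≡n origin n ⟩
    n                                               ∎
    where
    open ≤-Reasoning
    w : ℕ → ℕ
    w t = v (t mod n)
    open Occupancy In occupied?
    open Weighted w n v-off (λ g<n gap → v-gap (Gap.positive gap) g<n (Gap.start gap) (Gap.end gap))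
    open ClassChanges _≟ᶠ_ e (λ i≢j g<n gap i∈ j∈ → ≤-trans (v+e≤r _) (class-change-gap i≢j (Gap.positive gap) g<n i∈ j∈))

    In-start : In (# 0) origin
    In-start = subst (_∈ Z (# 0)) (sym (toℕ-mod-id (z (# 0)))) (z∈Z (# 0))

    through : ∀ i j k → 0 < offset i → offset i < offset j → offset j < offset k → Excess 4 origin (origin + n)
    through i j k 0<i i<j j<k = four-arcs
      (m<m+n origin 0<i) (+-monoʳ-< origin i<j) (+-monoʳ-< origin j<k) (+-monoʳ-< origin (segLen<n (z (# 0)) (z k))) ≤-refl
      (0<offset⇒≢0 0<i) (offset-ordered⇒≢ i<j) (offset-ordered⇒≢ j<k) (0<offset⇒≢0 (<-trans 0<i (<-trans i<j j<k)) ∘ sym)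
      In-start (In-offset i) (In-offset j) (In-offset k) (subst (_∈ Z (# 0)) (sym (mod-periodic origin)) In-start)

    distinct : ∀ {i j} → i ≢ j → offset i ≢ offset j
    distinct i≢j = i≢j ∘ offset-injective

    around : Excess 4 origin (origin + n)
    around = by-order (distinct λ ()) (distinct λ ()) (distinct λ ())
      (through (# 1) (# 2) (# 3) (≢0⇒0<offset λ ()))
      (through (# 1) (# 3) (# 2) (≢0⇒0<offset λ ()))
      (through (# 2) (# 1) (# 3) (≢0⇒0<offset λ ()))
      (through (# 2) (# 3) (# 1) (≢0⇒0<offset λ ()))
      (through (# 3) (# 1) (# 2) (≢0⇒0<offset λ ()))
      (through (# 3) (# 2) (# 1) (≢0⇒0<offset λ ()))

  4r≤n : 4 * r ≤ n
  4r≤n = subst (λ S → S + 4 * r ≤ n) (sumFrom-zero (λ _ → 0) 0 n λ _ _ → refl)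
    (cycle-bound (λ _ → 0) r (λ _ → refl) (λ _ _ _ _ → z≤n) (λ _ → ≤-refl))

  2∣Z₀∣+4[r∸2]≤n : 2 ≤ r → 2 * ∣ Z (# 0) ∣ + 4 * (r ∸ 2) ≤ n
  2∣Z₀∣+4[r∸2]≤n 2≤r = subst (λ S → S + 4 * (r ∸ 2) ≤ n) total (cycle-bound v (r ∸ 2) v-off v-gap v+e≤r)
    where
    v : Fin n → ℕ
    v x = 2 * 𝟙 (x ∈? Z (# 0))
    total : sumFrom (λ t → v (t mod n)) 0 n ≡ 2 * ∣ Z (# 0) ∣
    total = trans (sumFrom-* 2 _ 0 n) (cong (2 *_) (sumFrom-∈≡∣Z∣ (# 0)))
    v-off : ∀ {t} → ¬ Occupied In t → v (t mod n) ≡ 0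
    v-off {t} unoccupied with t mod n ∈? Z (# 0)
    ... | yes t∈ = contradiction (# 0 , t∈) unoccupied
    ... | no  _  = refl
    v-gap : ∀ {t g} → 0 < g → g < n → Occupied In t → Occupied In (t + g) → v (t mod n) ≤ g
    v-gap {t} 0<g g<n occ occ′ = ≤-trans (*-monoʳ-≤ 2 (𝟙≤1 (t mod n ∈? Z (# 0)))) (occupied-gap 2≤r 0<g g<n occ occ′)
    v+e≤r : ∀ x → v x + (r ∸ 2) ≤ r
    v+e≤r x = subst (v x + (r ∸ 2) ≤_) (m+[n∸m]≡n 2≤r) (+-monoˡ-≤ (r ∸ 2) (*-monoʳ-≤ 2 (𝟙≤1 (x ∈? Z (# 0)))))

  2[∣Z₀∣+∣Z₁∣]+4[r∸4]≤n : 4 ≤ r → 2 * (∣ Z (# 0) ∣ + ∣ Z (# 1) ∣) + 4 * (r ∸ 4) ≤ n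
  2[∣Z₀∣+∣Z₁∣]+4[r∸4]≤n 4≤r = subst (λ S → S + 4 * (r ∸ 4) ≤ n) total (cycle-bound v (r ∸ 4) v-off v-gap v+e≤r)
    where
    2≤r : 2 ≤ r
    2≤r = ≤-trans (s≤s (s≤s z≤n)) 4≤r
    v : Fin n → ℕ
    v x = 2 * 𝟙 (x ∈? Z (# 0)) + 2 * 𝟙 (x ∈? Z (# 1))
    total : sumFrom (λ t → v (t mod n)) 0 n ≡ 2 * (∣ Z (# 0) ∣ + ∣ Z (# 1) ∣)
    total = begin
      sumFrom (λ t → v (t mod n)) 0 n
        ≡⟨ sumFrom-+ _ _ 0 n ⟩
      sumFrom (λ t → 2 * 𝟙 (t mod n ∈? Z (# 0))) 0 n + sumFrom (λ t → 2 * 𝟙 (t mod n ∈? Z (# 1))) 0 n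
        ≡⟨ cong₂ _+_ (sumFrom-* 2 _ 0 n) (sumFrom-* 2 _ 0 n) ⟩
      2 * sumFrom (λ t → 𝟙 (t mod n ∈? Z (# 0))) 0 n + 2 * sumFrom (λ t → 𝟙 (t mod n ∈? Z (# 1))) 0 n
        ≡⟨ cong₂ (λ a b → 2 * a + 2 * b) (sumFrom-∈≡∣Z∣ (# 0)) (sumFrom-∈≡∣Z∣ (# 1)) ⟩
      2 * ∣ Z (# 0) ∣ + 2 * ∣ Z (# 1) ∣
        ≡⟨ *-distribˡ-+ 2 (∣ Z (# 0) ∣) _ ⟨
      2 * (∣ Z (# 0) ∣ + ∣ Z (# 1) ∣) ∎
      where open ≡-Reasoning
    v-off : ∀ {t} → ¬ Occupied In t → v (t mod n) ≡ 0
    v-off {t} unoccupied with t mod n ∈? Z (# 0) | t mod n ∈? Z (# 1)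
    ... | yes t∈ | _      = contradiction (# 0 , t∈) unoccupied
    ... | no  _  | yes t∈ = contradiction (# 1 , t∈) unoccupied
    ... | no  _  | no  _  = refl
    v-gap : ∀ {t g} → 0 < g → g < n → Occupied In t → Occupied In (t + g) → v (t mod n) ≤ g
    v-gap {t} {g} 0<g g<n occ (l , l∈) with t mod n ∈? Z (# 0) | t mod n ∈? Z (# 1)
    ... | yes t∈₀ | yes t∈₁ = ≤-trans 4≤r (leave-both l∈)
      where
      leave-both : ∀ {l} → In l (t + g) → r ≤ g
      leave-both {l} l∈ with l ≟ᶠ # 0
      ... | yes refl = class-change-gap (λ ()) 0<g g<n t∈₁ l∈
      ... | no  l≢0  = class-change-gap (l≢0 ∘ sym) 0<g g<n t∈₀ l∈
    ... | yes _   | no  _   = occupied-gap 2≤r 0<g g<n occ (l , l∈)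
    ... | no  _   | yes _   = occupied-gap 2≤r 0<g g<n occ (l , l∈)
    ... | no  _   | no  _   = z≤n
    v+e≤r : ∀ x → v x + (r ∸ 4) ≤ r
    v+e≤r x = subst (v x + (r ∸ 4) ≤_) (m+[n∸m]≡n 4≤r)
      (+-monoˡ-≤ (r ∸ 4) (+-mono-≤ (*-monoʳ-≤ 2 (𝟙≤1 (x ∈? Z (# 0)))) (*-monoʳ-≤ 2 (𝟙≤1 (x ∈? Z (# 1))))))

lemma3 : (n r : ℕ) → 3 ≤ n → 2 ≤ r → (Z : Fin 4 → Subset n) →
    IsScheme n r 4 Z → Nontrivial n 4 Z →
    ((4 ≤ r → 8 ≤ ∣ Z (# 0) ∣ + ∣ Z (# 1) ∣ → ∣ Z (# 2) ∣ ≡ 1 → ∣ Z (# 3) ∣ ≡ 1 →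
        (2 * (∣ Z (# 0) ∣ + ∣ Z (# 1) ∣) + 4 * r) ∸ 16 ≤ n)
    × (∣ Z (# 1) ∣ ≡ 1 → ∣ Z (# 2) ∣ ≡ 1 → ∣ Z (# 3) ∣ ≡ 1 → (2 * ∣ Z (# 0) ∣ + 4 * r) ∸ 8 ≤ n)
    × (∣ Z (# 0) ∣ ≡ 1 → ∣ Z (# 1) ∣ ≡ 1 → ∣ Z (# 2) ∣ ≡ 1 → ∣ Z (# 3) ∣ ≡ 1 → 4 * r ≤ n))
lemma3 n r 3≤n 2≤r Z scheme nontrivial =
  (λ 4≤r _ _ _ → ∸-bound {2 * (∣ Z (# 0) ∣ + ∣ Z (# 1) ∣)} 4≤r (2[∣Z₀∣+∣Z₁∣]+4[r∸4]≤n 4≤r)) ,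
  (λ _ _ _ → ∸-bound {2 * ∣ Z (# 0) ∣} 2≤r (2∣Z₀∣+4[r∸2]≤n 2≤r)) ,
  (λ _ _ _ _ → 4r≤n)
  where
  instance
    n-nonZero : NonZero n
    n-nonZero = >-nonZero (≤-trans (s≤s z≤n) 3≤n)
  open FourClasses Z scheme nontrivial
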